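{- Let $n\geq 1$ and let $G_1,\ldots,G_n$ be complete graphs with $|V(G_i)|\geq 2$ for each $1\leq i\leq n$. Let $G$ be the disjoint union of $G_1,\ldots,G_n$, and let $1\leq r\leq n$. Let $k$ be an integer with $2\leq k\leq \min_{1\leq i\leq n}|V(G_i)|$, and let $\mathcal{A}_1,\ldots,\mathcal{A}_k\subseteq \mathcal{J}^r(G)$ be cross-intersecting families. Then $$\sum_{i=1}^k|\mathcal{A}_i|\leq |\mathcal{J}^{r}(G)|.$$ This bound is best possible: it is attained by $\mathcal{A}_1=\mathcal{J}^r(G)$ and $\mathcal{A}_2=\cdots=\mathcal{A}_k=\emptyset$.
   Context: For a graph $G$, $\mathcal{J}^r(G)$ denotes the family of all independent vertex sets of size $r$ in $G$. A collection of families $\mathcal{A}_1,\ldots,\mathcal{A}_k$ is cross-intersecting if for all $i\neq j$ in $\{1,\ldots,k\}$, every $A\in\mathcal{A}_i$ and $B\in\mathcal{A}_j$ satisfy $A\cap B\neq\emptyset$. The individual families need not be non-empty or intersecting, and a set may lie in several families. -}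

module Defs where

open import Data.Nat using (ℕ; zero; suc; _≟_)
open import Data.Bool using (true; false)
open import Data.Fin using (Fin)
open import Data.Fin.Properties using (all?) renaming (_≟_ to _≟ᶠ_)
open import Data.Fin.Subset using (Subset; _∈_; ∣_∣; _∩_; Nonempty)
open import Data.Fin.Subset.Properties using (_∈?_)
open import Data.Vec using (_∷_; [])
open import Data.List using (List; []; _∷_; map; _++_; filter; length; allFin)
open import Data.List.Relation.Unary.All using (All)
open import Data.List.Relation.Unary.Unique.Propositional using (Unique)
import Data.List.Membership.Propositional as LM
open import Data.Product using (_×_; Σ; _,_)
open import Relation.Nullary using (¬_; Dec; yes; no)
open import Relation.Nullary.Decidable using (_×-dec_; _→-dec_; ¬?)
open import Relation.Binary.PropositionalEquality using (_≡_; _≢_)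

-- The graph G on vertex set Fin N determined by a map comp : Fin N → Fin n
-- assigning each vertex to its component: G is the disjoint union of the
-- complete graphs G_i on the fibres comp⁻¹(i), i.e. u ~ v iff u ≠ v and
-- u, v lie in the same component.
Adj : ∀ {N n} (comp : Fin N → Fin n) → Fin N → Fin N → Set
Adj comp u v = (u ≢ v) × (comp u ≡ comp v)

compSize : ∀ {N n} (comp : Fin N → Fin n) → Fin n → ℕ
compSize {N} comp i = length (filter (λ v → comp v ≟ᶠ i) (allFin N))

Independent : ∀ {N n} (comp : Fin N → Fin n) → Subset N → Set
Independent comp S = ∀ u v → u ∈ S → v ∈ S → ¬ Adj comp u v

independent? : ∀ {N n} (comp : Fin N → Fin n) (S : Subset N) → Dec (Independent comp S)
independent? comp S =
  all? λ u → all? λ v → (u ∈? S) →-dec ((v ∈? S) →-dec ¬? ((¬? (u ≟ᶠ v)) ×-dec (comp u ≟ᶠ comp v)))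

InJ : ∀ {N n} (comp : Fin N → Fin n) (r : ℕ) → Subset N → Set
InJ comp r S = Independent comp S × (∣ S ∣ ≡ r)

InJ? : ∀ {N n} (comp : Fin N → Fin n) (r : ℕ) (S : Subset N) → Dec (InJ comp r S)
InJ? comp r S = independent? comp S ×-dec (∣ S ∣ ≟ r)

allSubsets : ∀ N → List (Subset N)
allSubsets zero = [] ∷ []
allSubsets (suc N) = map (true ∷_) (allSubsets N) ++ map (false ∷_) (allSubsets N)

J : ∀ {N n} (comp : Fin N → Fin n) (r : ℕ) → List (Subset N)
J {N} comp r = filter (InJ? comp r) (allSubsets N)

-- a family 𝒜 ⊆ 𝒥^r(G), given as a duplicate-free list, so |𝒜| = length
Family : ∀ {N n} (comp : Fin N → Fin n) (r : ℕ) → List (Subset N) → Set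
Family comp r A = Unique A × All (InJ comp r) A

CrossIntersecting : ∀ {N k} → (Fin k → List (Subset N)) → Set
CrossIntersecting {N} {k} 𝒜 =
  ∀ (i j : Fin k) → i ≢ j → ∀ A B → A LM.∈ 𝒜 i → B LM.∈ 𝒜 j → Nonempty (A ∩ B)

module Submission where

-- Theorem 1.4 is proved by a Katona-type cyclic averaging argument.
--
-- Let m_j ≥ k be the size of the j-th clique and, for t < k, let σ_t be the
-- permutation of the vertex set rotating every clique cyclically by t steps
-- (with respect to a fixed enumeration of each clique).  Each σ_t preserves
-- components, so S ↦ Φ_t S = σ_t⁻¹(S) maps 𝒥^r(G) bijectively onto itself.
--
--  * For S ∈ 𝒥^r(G) the sets Φ_0 S, …, Φ_{k-1} S are pairwise disjoint:
--    a common vertex w gives two vertices σ_t w ≠ σ_s w of S in the same clique.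
--    Cross-intersection then says that the 0/1 matrix [Φ_t S ∈ 𝒜_i] (i, t < k)
--    has all entries of distinct rows in one column, so it has at most k ones.
--  * As Φ_t is onto 𝒥^r(G), |𝒜_i| ≤ #{S ∈ 𝒥^r(G) | Φ_t S ∈ 𝒜_i} for every t.
--
-- Summing the second bound over i and t and exchanging sums with the first
-- gives k · Σ_i |𝒜_i| ≤ k · |𝒥^r(G)|.  Equality is attained by 𝒜_1 = 𝒥^r(G).

open import Defs
open import Data.Nat using (ℕ; zero; suc; _+_; _*_; _∸_; _≤_; _<_; z≤n; s≤s; z<s; NonZero; >-nonZero)
open import Data.Nat.Properties
  using ( +-assoc; +-identityʳ; *-identityʳ; *-zeroʳ; *-comm; *-distribˡ-+; +-cancelˡ-≡; *-cancelˡ-≤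
        ; +-mono-≤; ≤-trans; <-≤-trans; ≤-<-trans; <⇒≤; <⇒≱; >⇒≢; ≮⇒≥; n≤0⇒n≡0; ≤-irrelevant; <-cmp
        ; m∸n≤m; m<n⇒0<n∸m; m+[n∸m]≡n; m∸n+n≡m; _<?_; _≤?_
        ; +-commutativeSemigroup; +-0-commutativeMonoid; module ≤-Reasoning )
open import Data.Nat.DivMod using (_%_; _/_; %-distribˡ-+; m%n%n≡m%n; [m+n]%n≡m%n; m<n⇒m%n≡m; m%n<n; m≡m%n+[m/n]*n)
open import Data.Nat.Divisibility using (_∣_; divides; ∣⇒≤)
open import Data.Nat.ListAction using (sum)
open import Data.Fin using (Fin; zero; suc; toℕ; fromℕ<)
open import Data.Fin.Properties
  using (all?; any?; ¬∀⟶∃¬; suc-injective; toℕ<n; toℕ-injective; toℕ-fromℕ<; fromℕ<-toℕ)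
  renaming (_≟_ to _≟ᶠ_)
open import Data.List as List using (List; []; _∷_; map; length; allFin; filter; _++_)
open import Data.List.Properties using (map-tabulate; length-tabulate; length-map; length-++-sucʳ)
open import Data.List.Membership.Propositional using (_∈_)
open import Data.List.Membership.Propositional.Properties
  using (∈-filter⁺; ∈-filter⁻; ∈-map⁺; ∈-map⁻; ∈-++⁺ˡ; ∈-++⁺ʳ; ∈-∃++; ∈-lookup; ∈-allFin)
open import Data.List.Membership.Propositional.Properties.WithK using (unique⇒irrelevant)
open import Data.List.Relation.Unary.Any using (here; there; index)
open import Data.List.Relation.Unary.Any.Properties using (lookup-index)
open import Data.List.Relation.Unary.All as All using (All; [])
open import Data.List.Relation.Unary.AllPairs using ([]; _∷_)
open import Data.List.Relation.Unary.Unique.Propositional using (Unique)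
open import Data.List.Relation.Unary.Unique.Propositional.Properties using (filter⁺; allFin⁺; ++⁺; map⁺)
open import Data.Bool using (Bool; true; false) renaming (_≟_ to _≟ᵇ_)
open import Data.Vec as Vec using ([]; _∷_)
open import Data.Vec.Properties
  using (lookup∘tabulate; tabulate∘lookup; tabulate-cong; []=⇒lookup; lookup⇒[]=; ∷-injectiveʳ; ≡-dec)
open import Data.Vec.Functional using (rearrange)
open import Data.Fin.Subset using (Subset; ∣_∣) renaming (_∈_ to _∈ₛ_)
open import Data.Fin.Subset.Properties using (x∈p∩q⁻)
open import Data.Fin.Permutation using (permutation)
import Algebra.Properties.CommutativeMonoid.Sum +-0-commutativeMonoid as VecSum
open import Data.Product using (_×_; Σ; ∃; _,_; proj₁; proj₂)
open import Data.Empty using (⊥; ⊥-elim)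
open import Algebra.Properties.CommutativeSemigroup +-commutativeSemigroup using (interchange)
open import Function using (_∘_)
open import Relation.Nullary using (Dec; yes; no; ¬_; contradiction)
open import Relation.Unary using (Pred; Decidable)
open import Relation.Binary.Definitions using (DecidableEquality; tri<; tri≈; tri>)
open import Relation.Binary.PropositionalEquality using (_≡_; _≢_; refl; sym; trans; cong; cong₂; subst; module ≡-Reasoning)

private
  variable
    A B : Set

sum-mono : (f g : A → ℕ) (L : List A) → (∀ x → x ∈ L → f x ≤ g x) →
           sum (map f L) ≤ sum (map g L)
sum-mono f g []      f≤g = z≤n
sum-mono f g (x ∷ L) f≤g = +-mono-≤ (f≤g x (here refl)) (sum-mono f g L (λ y → f≤g y ∘ there))

sum-lower-bound : (c : ℕ) (f : A → ℕ) (L : List A) → (∀ x → c ≤ f x) → length L * c ≤ sum (map f L)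
sum-lower-bound c f []      c≤f = z≤n
sum-lower-bound c f (x ∷ L) c≤f = +-mono-≤ (c≤f x) (sum-lower-bound c f L c≤f)

sum-upper-bound : (c : ℕ) (f : A → ℕ) (L : List A) → (∀ x → x ∈ L → f x ≤ c) → sum (map f L) ≤ length L * c
sum-upper-bound c f []      f≤c = z≤n
sum-upper-bound c f (x ∷ L) f≤c = +-mono-≤ (f≤c x (here refl)) (sum-upper-bound c f L (λ y → f≤c y ∘ there))

sum-+ : (f g : A → ℕ) (L : List A) → sum (map (λ x → f x + g x) L) ≡ sum (map f L) + sum (map g L)
sum-+ f g []      = refl
sum-+ f g (x ∷ L) = trans (cong (f x + g x +_) (sum-+ f g L)) (interchange (f x) (g x) _ _)

sum-*ˡ : (c : ℕ) (f : A → ℕ) (L : List A) → c * sum (map f L) ≡ sum (map (λ x → c * f x) L)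
sum-*ˡ c f []      = *-zeroʳ c
sum-*ˡ c f (x ∷ L) = trans (*-distribˡ-+ c (f x) _) (cong (c * f x +_) (sum-*ˡ c f L))

sum-swap : (f : A → B → ℕ) (L : List A) (M : List B) →
  sum (map (λ x → sum (map (f x) M)) L) ≡ sum (map (λ y → sum (map (λ x → f x y) L)) M)
sum-swap f []      M = sym (sum-zero M)
  where
    sum-zero : (M : List B) → sum (map (λ _ → 0) M) ≡ 0
    sum-zero []      = refl
    sum-zero (_ ∷ M) = sum-zero M
sum-swap f (x ∷ L) M = trans (cong (sum (map (f x) M) +_) (sum-swap f L M))
                             (sym (sum-+ (f x) (λ y → sum (map (λ x → f x y) L)) M))

∑ : (k : ℕ) → (Fin k → ℕ) → ℕ
∑ k f = sum (map f (allFin k))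

∑-suc : (k : ℕ) (f : Fin (suc k) → ℕ) → ∑ (suc k) f ≡ f zero + ∑ k (f ∘ suc)
∑-suc k f =
  cong (λ xs → f zero + sum xs) (trans (map-tabulate suc f) (sym (map-tabulate (λ i → i) (f ∘ suc))))

∑-upper-bound : (k c : ℕ) (f : Fin k → ℕ) → (∀ i → f i ≤ c) → ∑ k f ≤ k * c
∑-upper-bound k c f f≤c =
  subst (λ l → ∑ k f ≤ l * c) (length-tabulate {n = k} (λ i → i)) (sum-upper-bound c f (allFin k) (λ i _ → f≤c i))

∑-zero : {k : ℕ} (f : Fin k → ℕ) → (∀ i → f i ≡ 0) → ∑ k f ≡ 0
∑-zero {zero}  f f≡0 = refl
∑-zero {suc k} f f≡0 rewrite ∑-suc k f | f≡0 zero = ∑-zero (f ∘ suc) (f≡0 ∘ suc)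

∑-pos : {k : ℕ} (f : Fin k → ℕ) → 0 < ∑ k f → ∃ λ i → 0 < f i
∑-pos f ∑f>0 with any? (λ i → 0 <? f i)
... | yes witness = witness
... | no  none    = contradiction (∑-zero f (λ i → n≤0⇒n≡0 (≮⇒≥ (none ∘ (i ,_))))) (>⇒≢ ∑f>0)

off-support : {k : ℕ} (f : Fin k → ℕ) (i : Fin k) → (∀ j → 0 < f j → j ≡ i) → ∀ j → j ≢ i → f j ≡ 0
off-support f i supp j j≢i = n≤0⇒n≡0 (≮⇒≥ (j≢i ∘ supp j))

∑-single : {k : ℕ} (f : Fin k → ℕ) (i : Fin k) → (∀ j → 0 < f j → j ≡ i) → ∑ k f ≡ f i
∑-single {suc k} f zero supp rewrite ∑-suc k f =
  trans (cong (f zero +_) (∑-zero (f ∘ suc) (λ j → off-support f zero supp (suc j) λ ()))) (+-identityʳ (f zero))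
∑-single {suc k} f (suc i) supp rewrite ∑-suc k f | off-support f (suc i) supp zero (λ ()) =
  ∑-single (f ∘ suc) i (λ j f[1+j]>0 → suc-injective (supp (suc j) f[1+j]>0))

-- A k × k matrix with entries in {0,1} in which positive entries
-- of distinct rows always lie in the same column has at most k positive
-- entries: if some row has two of them, all other rows vanish; otherwise every
-- row contributes at most one.
crossing-matrix-bound : {k : ℕ} (M : Fin k → Fin k → ℕ) → (∀ i t → M i t ≤ 1) →
  (∀ i j t s → i ≢ j → 0 < M i t → 0 < M j s → t ≡ s) → ∑ k (λ i → ∑ k (M i)) ≤ k
crossing-matrix-bound {k} M M≤1 crossing with all? (λ i → ∑ k (M i) ≤? 1)
... | yes rows≤1 = subst (∑ k (λ i → ∑ k (M i)) ≤_) (*-identityʳ k) (∑-upper-bound k 1 _ rows≤1)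
... | no ¬rows≤1 with (i , row-i≰1) ← ¬∀⟶∃¬ k _ (λ i → ∑ k (M i) ≤? 1) ¬rows≤1 = begin
    ∑ k (λ j → ∑ k (M j)) ≡⟨ ∑-single (λ j → ∑ k (M j)) i only-row-i ⟩
    ∑ k (M i)             ≤⟨ ∑-upper-bound k 1 (M i) (M≤1 i) ⟩
    k * 1                 ≡⟨ *-identityʳ k ⟩
    k                     ∎
  where
    open ≤-Reasoning
    -- a positive entry in another row j, in column s, would confine row i to column s
    only-row-i : ∀ j → 0 < ∑ k (M j) → j ≡ i
    only-row-i j row-j>0 with j ≟ᶠ i
    ... | yes j≡i = j≡i
    ... | no  j≢i with (s , Mjs>0) ← ∑-pos (M j) row-j>0 =
      contradiction (subst (_≤ 1) (sym (∑-single (M i) s (λ t Mit>0 → crossing i j t s (j≢i ∘ sym) Mit>0 Mjs>0)))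
                           (M≤1 i s))
                    row-i≰1

unique-⊆⇒length≤ : (xs ys : List A) → Unique xs → (∀ x → x ∈ xs → x ∈ ys) → length xs ≤ length ys
unique-⊆⇒length≤ []       ys _          _   = z≤n
unique-⊆⇒length≤ (x ∷ xs) ys (x∉xs ∷ u) xs⊆ys with (ys₁ , ys₂ , refl) ← ∈-∃++ (xs⊆ys x (here refl)) =
  subst (suc (length xs) ≤_) (sym (length-++-sucʳ ys₁ x ys₂))
    (s≤s (unique-⊆⇒length≤ xs (ys₁ ++ ys₂) u
      (λ y y∈xs → remove ys₁ (xs⊆ys y (there y∈xs)) (λ y≡x → All.lookup x∉xs y∈xs (sym y≡x)))))
  where
    remove : ∀ {y} zs₁ {zs₂} → y ∈ zs₁ ++ x ∷ zs₂ → y ≢ x → y ∈ zs₁ ++ zs₂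
    remove []        (here y≡x)  y≢x = contradiction y≡x y≢x
    remove []        (there y∈)  _   = y∈
    remove (_ ∷ zs₁) (here y≡z)  _   = here y≡z
    remove (_ ∷ zs₁) (there y∈)  y≢x = there (remove zs₁ y∈ y≢x)

indicator : {P : Set} → Dec P → ℕ
indicator (yes _) = 1
indicator (no _)  = 0

indicator≤1 : {P : Set} (P? : Dec P) → indicator P? ≤ 1
indicator≤1 (yes _) = s≤s z≤n
indicator≤1 (no _)  = z≤n

indicator-pos : {P : Set} (P? : Dec P) → 0 < indicator P? → P
indicator-pos (yes p) _ = p

sum-indicator : {P : Pred A _} (P? : Decidable P) (L : List A) →
                sum (map (λ x → indicator (P? x)) L) ≡ length (filter P? L)
sum-indicator P? []      = refl
sum-indicator P? (x ∷ L) with P? x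
... | yes _ = cong suc (sum-indicator P? L)
... | no  _ = sum-indicator P? L

module _ {A B : Set} (_≟_ : DecidableEquality B) where
  open import Data.List.Membership.DecPropositional _≟_ using (_∈?_)

  preimage-count : (Φ : A → B) (L : List A) (𝒜 : List B) → Unique 𝒜 →
    (∀ y → y ∈ 𝒜 → ∃ λ x → x ∈ L × Φ x ≡ y) → length 𝒜 ≤ sum (map (λ x → indicator (Φ x ∈? 𝒜)) L)
  preimage-count Φ L 𝒜 unique-𝒜 onto = begin
    length 𝒜                                   ≤⟨ unique-⊆⇒length≤ 𝒜 (map Φ hits) unique-𝒜 𝒜⊆Φ[hits] ⟩
    length (map Φ hits)                        ≡⟨ length-map Φ hits ⟩
    length hits                                ≡⟨ sum-indicator (λ x → Φ x ∈? 𝒜) L ⟨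
    sum (map (λ x → indicator (Φ x ∈? 𝒜)) L) ∎
    where
      open ≤-Reasoning
      hits : List A
      hits = filter (λ x → Φ x ∈? 𝒜) L
      𝒜⊆Φ[hits] : ∀ y → y ∈ 𝒜 → y ∈ map Φ hits
      𝒜⊆Φ[hits] y y∈𝒜 with (x , x∈L , refl) ← onto y y∈𝒜 = ∈-map⁺ Φ (∈-filter⁺ (λ x → Φ x ∈? 𝒜) x∈L y∈𝒜)

-- In a duplicate-free list every proof that the i-th element is a member
-- points to position i (membership proofs are unique there).
index-of-lookup : {xs : List A} → Unique xs → ∀ i (p : List.lookup xs i ∈ xs) → index p ≡ i
index-of-lookup {xs = xs} unique-xs i p =
  trans (cong index (unique⇒irrelevant unique-xs p (∈-lookup i))) (index-∈-lookup xs i)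
  where
    index-∈-lookup : ∀ (ys : List A) j → index (∈-lookup {xs = ys} j) ≡ j
    index-∈-lookup (_ ∷ ys) zero    = refl
    index-∈-lookup (_ ∷ ys) (suc j) = cong suc (index-∈-lookup ys j)

module _ (m : ℕ) .{{_ : NonZero m}} where

  shift : ℕ → ℕ → ℕ
  shift t a = (a + t) % m

  shift<m : ∀ t a → shift t a < m
  shift<m t a = m%n<n (a + t) m

  %-absorbˡ : ∀ x y → (x % m + y) % m ≡ (x + y) % m
  %-absorbˡ x y = begin
    (x % m + y) % m         ≡⟨ %-distribˡ-+ (x % m) y m ⟩
    (x % m % m + y % m) % m ≡⟨ cong (λ z → (z + y % m) % m) (m%n%n≡m%n x m) ⟩
    (x % m + y % m) % m     ≡⟨ %-distribˡ-+ x y m ⟨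
    (x + y) % m             ∎
    where open ≡-Reasoning

  shift-shift : ∀ t u a → shift u (shift t a) ≡ shift (t + u) a
  shift-shift t u a = trans (%-absorbˡ (a + t) u) (cong (_% m) (+-assoc a t u))

  shift-inverse : ∀ t u a → t + u ≡ m → a < m → shift u (shift t a) ≡ a
  shift-inverse t u a t+u≡m a<m = begin
    shift u (shift t a) ≡⟨ shift-shift t u a ⟩
    (a + (t + u)) % m   ≡⟨ cong (λ z → (a + z) % m) t+u≡m ⟩
    (a + m) % m         ≡⟨ [m+n]%n≡m%n a m ⟩
    a % m               ≡⟨ m<n⇒m%n≡m a<m ⟩
    a                   ∎
    where open ≡-Reasoning

  -- A shift by 0 < d < m has no fixed point: (a + d) % m ≡ a would make m divide d.
  shift-no-fixed-point : ∀ d a → 0 < d → d < m → a < m → shift d a ≢ a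
  shift-no-fixed-point d a d>0 d<m a<m shift≡a = <⇒≱ d<m (∣⇒≤ {{>-nonZero d>0}} m∣d)
    where
      a+d≡a+qm : a + d ≡ a + (a + d) / m * m
      a+d≡a+qm = trans (m≡m%n+[m/n]*n (a + d) m) (cong (_+ (a + d) / m * m) shift≡a)
      m∣d : m ∣ d
      m∣d = divides ((a + d) / m) (+-cancelˡ-≡ a d _ a+d≡a+qm)

  shift-injective : ∀ t s a → t < s → s < m → shift t a ≢ shift s a
  shift-injective t s a t<s s<m shiftₜ≡shiftₛ =
    shift-no-fixed-point (s ∸ t) (shift t a) (m<n⇒0<n∸m t<s) (≤-<-trans (m∸n≤m s t) s<m) (shift<m t a)
      (begin
        shift (s ∸ t) (shift t a) ≡⟨ shift-shift t (s ∸ t) a ⟩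
        shift (t + (s ∸ t)) a     ≡⟨ cong (λ u → shift u a) (m+[n∸m]≡n (<⇒≤ t<s)) ⟩
        shift s a                 ≡⟨ shiftₜ≡shiftₛ ⟨
        shift t a                 ∎)
    where open ≡-Reasoning

-- Rotations of the vertex set.  Each clique j is enumerated in increasing
-- order; rotate s moves every vertex of clique j forward by s j positions
-- (cyclically) in this enumeration.
module Rotation {N n : ℕ} (comp : Fin N → Fin n) (nonempty : ∀ j → 0 < compSize comp j) where

  size : Fin n → ℕ
  size = compSize comp

  members : Fin n → List (Fin N)
  members j = filter (λ v → comp v ≟ᶠ j) (allFin N)

  member : ∀ v → v ∈ members (comp v)
  member v = ∈-filter⁺ (λ u → comp u ≟ᶠ comp v) (∈-allFin v) refl

  position : Fin N → ℕ
  position v = toℕ (index (member v))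

  position< : ∀ v → position v < size (comp v)
  position< v = toℕ<n (index (member v))

  vertexAt : (j : Fin n) (x : ℕ) → x < size j → Fin N
  vertexAt j x x<size = List.lookup (members j) (fromℕ< x<size)

  comp-vertexAt : ∀ j x x<size → comp (vertexAt j x x<size) ≡ j
  comp-vertexAt j x x<size =
    proj₂ (∈-filter⁻ (λ v → comp v ≟ᶠ j) {xs = allFin N} (∈-lookup (fromℕ< x<size)))

  position-vertexAt : ∀ j x x<size → position (vertexAt j x x<size) ≡ x
  position-vertexAt j x x<size =
    trans (index-in-own-clique (comp-vertexAt j x x<size) (member (vertexAt j x x<size))) (toℕ-fromℕ< x<size)
    where
      index-in-own-clique : ∀ {j'} → j' ≡ j → (p : vertexAt j x x<size ∈ members j') →
                            toℕ (index p) ≡ toℕ (fromℕ< x<size)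
      index-in-own-clique refl p =
        cong toℕ (index-of-lookup (filter⁺ (λ v → comp v ≟ᶠ j) (allFin⁺ N)) (fromℕ< x<size) p)

  vertexAt-position : ∀ v p → vertexAt (comp v) (position v) p ≡ v
  vertexAt-position v p =
    trans (cong (List.lookup (members (comp v))) (fromℕ<-toℕ (index (member v)) p))
          (sym (lookup-index (member v)))

  vertexAt-cong : ∀ {j j' x x'} p p' → j ≡ j' → x ≡ x' → vertexAt j x p ≡ vertexAt j' x' p'
  vertexAt-cong p p' refl refl = cong (vertexAt _ _) (≤-irrelevant p p')

  vertex-ext : ∀ u v → comp u ≡ comp v → position u ≡ position v → u ≡ v
  vertex-ext u v same-clique same-position = begin
    u                                             ≡⟨ vertexAt-position u (position< u) ⟨
    vertexAt (comp u) (position u) (position< u)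
      ≡⟨ vertexAt-cong (position< u) (position< v) same-clique same-position ⟩
    vertexAt (comp v) (position v) (position< v) ≡⟨ vertexAt-position v (position< v) ⟩
    v                                             ∎
    where open ≡-Reasoning

  shiftIn : Fin n → ℕ → ℕ → ℕ
  shiftIn j = shift (size j) {{>-nonZero (nonempty j)}}

  shiftIn<size : ∀ j t a → shiftIn j t a < size j
  shiftIn<size j = shift<m (size j) {{>-nonZero (nonempty j)}}

  rotate : (Fin n → ℕ) → Fin N → Fin N
  rotate s v = vertexAt (comp v) (shiftIn (comp v) (s (comp v)) (position v))
                                 (shiftIn<size (comp v) (s (comp v)) (position v))

  comp-rotate : ∀ s v → comp (rotate s v) ≡ comp v
  comp-rotate s v = comp-vertexAt (comp v) _ (shiftIn<size (comp v) (s (comp v)) (position v))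

  position-rotate : ∀ s v → position (rotate s v) ≡ shiftIn (comp v) (s (comp v)) (position v)
  position-rotate s v = position-vertexAt (comp v) _ (shiftIn<size (comp v) (s (comp v)) (position v))

  rotate-inverse : (s s' : Fin n → ℕ) → (∀ j → s j + s' j ≡ size j) → ∀ v → rotate s' (rotate s v) ≡ v
  rotate-inverse s s' s+s'≡size v = vertex-ext _ v (trans (comp-rotate s' _) (comp-rotate s v)) (begin
    position (rotate s' (rotate s v))             ≡⟨ position-rotate s' (rotate s v) ⟩
    shiftIn (comp w) (s' (comp w)) (position w)
      ≡⟨ cong₂ (λ j a → shiftIn j (s' j) a) (comp-rotate s v) (position-rotate s v) ⟩
    shiftIn (comp v) (s' (comp v)) (shiftIn (comp v) (s (comp v)) (position v))
      ≡⟨ shift-inverse (size (comp v)) {{>-nonZero (nonempty (comp v))}} _ _ _ (s+s'≡size (comp v)) (position< v) ⟩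
    position v                                    ∎)
    where
      open ≡-Reasoning
      w : Fin N
      w = rotate s v

  rotate-injective : ∀ t t' v → t < t' → t' < size (comp v) →
                     rotate (λ _ → t) v ≢ rotate (λ _ → t') v
  rotate-injective t t' v t<t' t'<size same =
    shift-injective (size (comp v)) {{>-nonZero (nonempty (comp v))}} t t' (position v) t<t' t'<size
      (trans (sym (position-rotate (λ _ → t) v)) (trans (cong position same) (position-rotate (λ _ → t') v)))

preimage : {M N : ℕ} → (Fin M → Fin N) → Subset N → Subset M
preimage g S = Vec.tabulate (λ w → Vec.lookup S (g w))

module _ {M N : ℕ} {g : Fin M → Fin N} {S : Subset N} where

  ∈-preimage⁺ : ∀ {w} → g w ∈ₛ S → w ∈ₛ preimage g S
  ∈-preimage⁺ {w} gw∈S = lookup⇒[]= w (preimage g S) (trans (lookup∘tabulate _ w) ([]=⇒lookup gw∈S))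

  ∈-preimage⁻ : ∀ {w} → w ∈ₛ preimage g S → g w ∈ₛ S
  ∈-preimage⁻ {w} w∈g⁻¹S = lookup⇒[]= (g w) S (trans (sym (lookup∘tabulate _ w)) ([]=⇒lookup w∈g⁻¹S))

preimage-inverse : {M N : ℕ} (g : Fin M → Fin N) (f : Fin N → Fin M) → (∀ w → f (g w) ≡ w) →
                   ∀ S → preimage g (preimage f S) ≡ S
preimage-inverse g f fg≡id S =
  trans (tabulate-cong (λ w → trans (lookup∘tabulate _ (g w)) (cong (Vec.lookup S) (fg≡id w))))
        (tabulate∘lookup S)

bit : Bool → ℕ
bit true  = 1
bit false = 0

∣∣≡sum-of-bits : {N : ℕ} (S : Subset N) → ∣ S ∣ ≡ VecSum.sum (λ w → bit (Vec.lookup S w))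
∣∣≡sum-of-bits []          = refl
∣∣≡sum-of-bits (true ∷ S)  = cong suc (∣∣≡sum-of-bits S)
∣∣≡sum-of-bits (false ∷ S) = ∣∣≡sum-of-bits S

∣preimage∣ : {M N : ℕ} (g : Fin M → Fin N) (f : Fin N → Fin M) →
             (∀ y → g (f y) ≡ y) → (∀ x → f (g x) ≡ x) → ∀ S → ∣ preimage g S ∣ ≡ ∣ S ∣
∣preimage∣ g f gf≡id fg≡id S = begin
  ∣ preimage g S ∣                                          ≡⟨ ∣∣≡sum-of-bits (preimage g S) ⟩
  VecSum.sum (λ w → bit (Vec.lookup (preimage g S) w))
    ≡⟨ VecSum.sum-cong-≗ (λ w → cong bit (lookup∘tabulate (λ v → Vec.lookup S (g v)) w)) ⟩
  VecSum.sum (rearrange g (λ v → bit (Vec.lookup S v)))     ≡⟨ VecSum.sum-permute _ (permutation g f gf≡id fg≡id) ⟨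
  VecSum.sum (λ v → bit (Vec.lookup S v))                   ≡⟨ ∣∣≡sum-of-bits S ⟨
  ∣ S ∣                                                      ∎
  where open ≡-Reasoning

module _ {N n : ℕ} (comp : Fin N → Fin n) where

  preimage-InJ : (g f : Fin N → Fin N) → (∀ y → g (f y) ≡ y) → (∀ x → f (g x) ≡ x) →
                 (∀ w → comp (g w) ≡ comp w) → ∀ {r} S → InJ comp r S → InJ comp r (preimage g S)
  preimage-InJ g f gf≡id fg≡id g-keeps-cliques S (independent , ∣S∣≡r) =
    g⁻¹S-independent , trans (∣preimage∣ g f gf≡id fg≡id S) ∣S∣≡r
    where
      g⁻¹S-independent : Independent comp (preimage g S)
      g⁻¹S-independent u v u∈ v∈ (u≢v , same-clique) =
        independent (g u) (g v) (∈-preimage⁻ u∈) (∈-preimage⁻ v∈)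
          ( (λ gu≡gv → u≢v (trans (sym (fg≡id u)) (trans (cong f gu≡gv) (fg≡id v))))
          , trans (g-keeps-cliques u) (trans same-clique (sym (g-keeps-cliques v))))

∈-allSubsets : {N : ℕ} (S : Subset N) → S ∈ allSubsets N
∈-allSubsets []          = here refl
∈-allSubsets (true ∷ S)  = ∈-++⁺ˡ (∈-map⁺ (true ∷_) (∈-allSubsets S))
∈-allSubsets (false ∷ S) = ∈-++⁺ʳ _ (∈-map⁺ (false ∷_) (∈-allSubsets S))

allSubsets-unique : (N : ℕ) → Unique (allSubsets N)
allSubsets-unique zero    = [] ∷ []
allSubsets-unique (suc N) =
  ++⁺ (map⁺ ∷-injectiveʳ (allSubsets-unique N)) (map⁺ ∷-injectiveʳ (allSubsets-unique N)) different-heads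
  where
    different-heads : ∀ {S} → ¬ (S ∈ map (true ∷_) (allSubsets N) × S ∈ map (false ∷_) (allSubsets N))
    different-heads (S∈true∷ , S∈false∷) with ∈-map⁻ (true ∷_) S∈true∷ | ∈-map⁻ (false ∷_) S∈false∷
    ... | _ , _ , refl | _ , _ , ()

module _ {N n : ℕ} (comp : Fin N → Fin n) (r : ℕ) where

  InJ⇒∈J : ∀ S → InJ comp r S → S ∈ J comp r
  InJ⇒∈J S = ∈-filter⁺ (InJ? comp r) (∈-allSubsets S)

  ∈J⇒InJ : ∀ S → S ∈ J comp r → InJ comp r S
  ∈J⇒InJ S S∈J = proj₂ (∈-filter⁻ (InJ? comp r) {xs = allSubsets N} S∈J)

  J-unique : Unique (J comp r)
  J-unique = filter⁺ (InJ? comp r) (allSubsets-unique N)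

module Averaging {N n : ℕ} (comp : Fin N → Fin n) (r k : ℕ) (k>0 : 0 < k)
                 (k≤size : ∀ j → k ≤ compSize comp j) where

  open Rotation comp (λ j → <-≤-trans k>0 (k≤size j))

  subset-≟ : DecidableEquality (Subset N)
  subset-≟ = ≡-dec _≟ᵇ_

  open import Data.List.Membership.DecPropositional subset-≟ using (_∈?_)

  σ σ⁻¹ : Fin k → Fin N → Fin N
  σ t   = rotate (λ _ → toℕ t)
  σ⁻¹ t = rotate (λ j → size j ∸ toℕ t)

  t≤size : ∀ (t : Fin k) j → toℕ t ≤ size j
  t≤size t j = ≤-trans (<⇒≤ (toℕ<n t)) (k≤size j)

  comp-σ : ∀ t v → comp (σ t v) ≡ comp v
  comp-σ t = comp-rotate (λ _ → toℕ t)

  comp-σ⁻¹ : ∀ t v → comp (σ⁻¹ t v) ≡ comp v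
  comp-σ⁻¹ t = comp-rotate (λ j → size j ∸ toℕ t)

  σ⁻¹∘σ : ∀ t v → σ⁻¹ t (σ t v) ≡ v
  σ⁻¹∘σ t = rotate-inverse _ _ (λ j → m+[n∸m]≡n (t≤size t j))

  σ∘σ⁻¹ : ∀ t v → σ t (σ⁻¹ t v) ≡ v
  σ∘σ⁻¹ t = rotate-inverse _ _ (λ j → m∸n+n≡m (t≤size t j))

  σ-injective : ∀ t s v → t ≢ s → σ t v ≢ σ s v
  σ-injective t s v t≢s with <-cmp (toℕ t) (toℕ s)
  ... | tri< t<s _ _ = rotate-injective _ _ v t<s (<-≤-trans (toℕ<n s) (k≤size (comp v)))
  ... | tri≈ _ t≡s _ = contradiction (toℕ-injective t≡s) t≢s
  ... | tri> _ _ s<t = rotate-injective _ _ v s<t (<-≤-trans (toℕ<n t) (k≤size (comp v))) ∘ sym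

  Φ : Fin k → Subset N → Subset N
  Φ t = preimage (σ t)

  Φ-onto : ∀ t T → InJ comp r T → ∃ λ S → S ∈ J comp r × Φ t S ≡ T
  Φ-onto t T T∈𝒥 =
    preimage (σ⁻¹ t) T ,
    InJ⇒∈J comp r _ (preimage-InJ comp (σ⁻¹ t) (σ t) (σ⁻¹∘σ t) (σ∘σ⁻¹ t) (comp-σ⁻¹ t) T T∈𝒥) ,
    preimage-inverse (σ t) (σ⁻¹ t) (σ⁻¹∘σ t) T

  -- For an independent S the sets Φ t S (t < k) are pairwise disjoint: a common
  -- vertex w gives the two distinct vertices σ t w, σ s w of S in one clique.
  Φ-disjoint : ∀ S → Independent comp S → ∀ t s → t ≢ s → ∀ w → w ∈ₛ Φ t S → w ∈ₛ Φ s S → ⊥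
  Φ-disjoint S independent t s t≢s w w∈Φt w∈Φs =
    independent (σ t w) (σ s w) (∈-preimage⁻ w∈Φt) (∈-preimage⁻ w∈Φs)
      (σ-injective t s w t≢s , trans (comp-σ t w) (sym (comp-σ s w)))

  hit : List (Subset N) → Subset N → Fin k → ℕ
  hit 𝒜 S t = indicator (Φ t S ∈? 𝒜)

  -- A single family: k · |𝒜| ≤ Σ_{S ∈ 𝒥} Σ_{t<k} [Φ t S ∈ 𝒜], since for each t
  -- the family 𝒜 is counted by its Φ t-preimages in 𝒥.
  family-bound : ∀ 𝒜 → Family comp r 𝒜 →
                 k * length 𝒜 ≤ sum (map (λ S → ∑ k (hit 𝒜 S)) (J comp r))
  family-bound 𝒜 (unique-𝒜 , 𝒜⊆𝒥) = begin
    k * length 𝒜                                        ≡⟨ cong (_* length 𝒜) (length-tabulate {n = k} (λ t → t)) ⟨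
    length (allFin k) * length 𝒜                        ≤⟨ sum-lower-bound (length 𝒜) _ (allFin k) preimages ⟩
    ∑ k (λ t → sum (map (λ S → hit 𝒜 S t) (J comp r)))
      ≡⟨ sum-swap (λ t S → hit 𝒜 S t) (allFin k) (J comp r) ⟩
    sum (map (λ S → ∑ k (hit 𝒜 S)) (J comp r))          ∎
    where
      open ≤-Reasoning
      preimages : ∀ t → length 𝒜 ≤ sum (map (λ S → hit 𝒜 S t) (J comp r))
      preimages t = preimage-count subset-≟ (Φ t) (J comp r) 𝒜 unique-𝒜
                      (λ T T∈𝒜 → Φ-onto t T (All.lookup 𝒜⊆𝒥 T∈𝒜))

  -- A single orbit: for S ∈ 𝒥, cross-intersection and disjointness of the Φ t S
  -- make [Φ t S ∈ 𝒜 i] a crossing matrix, so Σ_i Σ_t [Φ t S ∈ 𝒜 i] ≤ k.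
  orbit-bound : ∀ 𝒜 → CrossIntersecting 𝒜 → ∀ S → S ∈ J comp r →
                ∑ k (λ i → ∑ k (hit (𝒜 i) S)) ≤ k
  orbit-bound 𝒜 cross S S∈𝒥 =
    crossing-matrix-bound (λ i → hit (𝒜 i) S) (λ i t → indicator≤1 _) same-column
    where
      same-column : ∀ i j t s → i ≢ j → 0 < hit (𝒜 i) S t → 0 < hit (𝒜 j) S s → t ≡ s
      same-column i j t s i≢j hit-it hit-js with t ≟ᶠ s
      ... | yes t≡s = t≡s
      ... | no  t≢s
          with (w , w∈Φt∩Φs) ← cross i j i≢j _ _ (indicator-pos _ hit-it) (indicator-pos _ hit-js) =
        ⊥-elim (Φ-disjoint S (proj₁ (∈J⇒InJ comp r S S∈𝒥)) t s t≢s w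
                  (proj₁ (x∈p∩q⁻ _ _ w∈Φt∩Φs)) (proj₂ (x∈p∩q⁻ _ _ w∈Φt∩Φs)))

  -- Double counting the pairs (S, t) with Φ t S ∈ 𝒜 i.
  averaging : ∀ 𝒜 → (∀ i → Family comp r (𝒜 i)) → CrossIntersecting 𝒜 →
              k * ∑ k (λ i → length (𝒜 i)) ≤ k * length (J comp r)
  averaging 𝒜 families cross = begin
    k * ∑ k (λ i → length (𝒜 i))
      ≡⟨ sum-*ˡ k _ (allFin k) ⟩
    ∑ k (λ i → k * length (𝒜 i))
      ≤⟨ sum-mono _ _ (allFin k) (λ i _ → family-bound (𝒜 i) (families i)) ⟩
    ∑ k (λ i → sum (map (λ S → ∑ k (hit (𝒜 i) S)) (J comp r)))
      ≡⟨ sum-swap (λ i S → ∑ k (hit (𝒜 i) S)) (allFin k) (J comp r) ⟩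
    sum (map (λ S → ∑ k (λ i → ∑ k (hit (𝒜 i) S))) (J comp r))
      ≤⟨ sum-upper-bound k _ (J comp r) (orbit-bound 𝒜 cross) ⟩
    length (J comp r) * k
      ≡⟨ *-comm (length (J comp r)) k ⟩
    k * length (J comp r)
      ∎
    where open ≤-Reasoning

extremal : {N n : ℕ} (comp : Fin N → Fin n) (r k : ℕ) →
  Σ (Fin (suc k) → List (Subset N)) λ 𝒜
    → (∀ i → Family comp r (𝒜 i))
    × CrossIntersecting 𝒜
    × (∑ (suc k) (λ i → length (𝒜 i)) ≡ length (J comp r))
extremal {N} comp r k = 𝒜 , families , cross , ∑-single (λ i → length (𝒜 i)) zero only-first
  where
    𝒜 : Fin (suc k) → List (Subset N)
    𝒜 zero    = J comp r
    𝒜 (suc _) = []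

    families : ∀ i → Family comp r (𝒜 i)
    families zero    = J-unique comp r , All.tabulate (λ {S} → ∈J⇒InJ comp r S)
    families (suc _) = [] , []

    cross : CrossIntersecting 𝒜
    cross zero    zero    0≢0 _ _ _ _ = contradiction refl 0≢0
    cross zero    (suc _) _   _ _ _ ()
    cross (suc _) _       _   _ _ ()

    only-first : ∀ i → 0 < length (𝒜 i) → i ≡ zero
    only-first zero    _  = refl
    only-first (suc _) ()

-- Theorem 1.4: the averaged inequality cancels to Σ_i |𝒜_i| ≤ |𝒥^r(G)|, and
-- the extremal example shows the bound is attained (k ≥ 1 suffices for both).
theorem1p4 : (n N : ℕ) (comp : Fin N → Fin n) (r k : ℕ)
    → 1 ≤ n
    → (∀ i → 2 ≤ compSize comp i)
    → 1 ≤ r → r ≤ n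
    → 2 ≤ k → (∀ i → k ≤ compSize comp i)
    → ((𝒜 : Fin k → List (Subset N))
         → (∀ i → Family comp r (𝒜 i))
         → CrossIntersecting 𝒜
         → sum (map (λ i → length (𝒜 i)) (allFin k)) ≤ length (J comp r))
      × (Σ (Fin k → List (Subset N)) λ 𝒜
           → (∀ i → Family comp r (𝒜 i))
           × CrossIntersecting 𝒜
           × (sum (map (λ i → length (𝒜 i)) (allFin k)) ≡ length (J comp r)))
theorem1p4 n N comp r zero    _ _ _ _ () _
theorem1p4 n N comp r (suc k) _ _ _ _ _ k+1≤size =
  (λ 𝒜 families cross → *-cancelˡ-≤ (suc k) (averaging 𝒜 families cross)) , extremal comp r k
  where open Averaging comp r (suc k) z<s k+1≤size
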